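{- In the theory $QT^+$ the following are provable: (a) $\mathrm{Tally}_b(y)\to\mathrm{Tally}_b(Sy)$; (b) $\mathrm{Tally}_b(y)\leftrightarrow y=b\vee\exists y_1(\mathrm{Tally}_b(y_1)\wedge y=Sy_1)$; (c) $\forall v,u\,(\mathrm{Tally}_b(v)\wedge u<v\to Su\le v)$; (d) $\mathrm{Tally}_b(y)\to(x<y\leftrightarrow Sx<Sy)$.
   Context: $QT^+$ is the first-order theory in the language $\{a,b,*,S\}$ with axioms the universal closures of: (QT1) $x*(y*z)=(x*y)*z$; (QT2) $\neg(x*y=a)\wedge\neg(x*y=b)$; (QT3) $(x*a=y*a\to x=y)\wedge(x*b=y*b\to x=y)\wedge(a*x=a*y\to x=y)\wedge(b*x=b*y\to x=y)$; (QT4) $\neg(a*x=b*y)\wedge\neg(x*a=y*b)$; (QT5) $x=a\vee x=b\vee(\exists y(a*y=x\vee b*y=x)\wedge\exists z(z*a=x\vee z*b=x))$; (QT6) $Sx=y\leftrightarrow((x=a\wedge y=b)\vee(\neg x=a\wedge x*b=y))$. Abbreviations: $xBy\equiv\exists z\,(x*z=y)$; $xEy\equiv\exists z\,(z*x=y)$; $x\subseteq_p y\equiv x=y\vee xBy\vee xEy\vee\exists y_1\exists y_2\,(y=y_1*(x*y_2))$; $\mathrm{Digit}(x)\equiv x=a\vee x=b$; $\mathrm{Tally}_b(x)\equiv\forall y\,(y\subseteq_p x\wedge\mathrm{Digit}(y)\to y=b)$; $xRy\equiv(x=a\wedge\neg y=a)\vee xBy$; $I_0(x)\equiv\forall y\,((yRx\vee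 y=x)\to\neg yRy)$; $x<y\equiv I_0(x)\wedge I_0(y)\wedge xRy$; $x\le y\equiv x<y\vee x=y$. -}

module Defs where

open import Level using (0ℓ)
open import Data.Product using (Σ; _×_; _,_)
open import Data.Sum using (_⊎_)
open import Relation.Nullary using (¬_)
open import Relation.Binary.PropositionalEquality using (_≡_)
open import Function.Bundles using (_⇔_)

record QTModel : Set₁ where
  infixl 7 _∗_
  field
    M   : Set
    a b : M
    _∗_ : M → M → M
    S   : M → M
    qt1 : ∀ x y z → x ∗ (y ∗ z) ≡ (x ∗ y) ∗ z
    qt2 : ∀ x y → ¬ (x ∗ y ≡ a) × ¬ (x ∗ y ≡ b)
    qt3 : ∀ x y → (x ∗ a ≡ y ∗ a → x ≡ y) × (x ∗ b ≡ y ∗ b → x ≡ y)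
                × (a ∗ x ≡ a ∗ y → x ≡ y) × (b ∗ x ≡ b ∗ y → x ≡ y)
    qt4 : ∀ x y → ¬ (a ∗ x ≡ b ∗ y) × ¬ (x ∗ a ≡ y ∗ b)
    qt5 : ∀ x → x ≡ a ⊎ x ≡ b
              ⊎ ((Σ M λ y → a ∗ y ≡ x ⊎ b ∗ y ≡ x) × (Σ M λ z → z ∗ a ≡ x ⊎ z ∗ b ≡ x))
    qt6 : ∀ x y → (S x ≡ y) ⇔ ((x ≡ a × y ≡ b) ⊎ (¬ (x ≡ a) × x ∗ b ≡ y))

module Notions (𝓜 : QTModel) where
  open QTModel 𝓜

  _B_ : M → M → Set
  x B y = Σ M λ z → x ∗ z ≡ y

  _E_ : M → M → Set
  x E y = Σ M λ z → z ∗ x ≡ y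

  _⊆p_ : M → M → Set
  x ⊆p y = x ≡ y ⊎ x B y ⊎ x E y ⊎ (Σ M λ y₁ → Σ M λ y₂ → y ≡ y₁ ∗ (x ∗ y₂))

  Digit : M → Set
  Digit x = x ≡ a ⊎ x ≡ b

  Tally-b : M → Set
  Tally-b x = ∀ y → y ⊆p x × Digit y → y ≡ b

  _R_ : M → M → Set
  x R y = (x ≡ a × ¬ (y ≡ a)) ⊎ x B y

  I₀ : M → Set
  I₀ x = ∀ y → (y R x ⊎ y ≡ x) → ¬ (y R y)

  _<_ : M → M → Set
  x < y = I₀ x × I₀ y × x R y

  _≤_ : M → M → Set
  x ≤ y = x < y ⊎ x ≡ y

{-# OPTIONS --safe #-}
-- A b-tally is exactly an element in which the digit a does not occur
-- (Tally-b y ⇔ ¬ a ⊆p y), and the cancellation axioms QT3–QT4 yield one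
-- decomposition principle: a proper prefix of y ∗ b is y itself or a proper
-- prefix of y.  Since S y = y ∗ b for y ≢ a, all four parts then follow by
-- splitting elements into their first or last digit, which QT5 provides.
module Submission where

open import Defs
open import Level using (0ℓ)
open import Axiom.ExcludedMiddle using (ExcludedMiddle)
open import Data.Product using (Σ; _×_; _,_; proj₁; proj₂)
open import Data.Sum using (_⊎_; inj₁; inj₂)
open import Data.Empty using (⊥-elim)
open import Function using (_∘_)
open import Function.Bundles using (_⇔_; mk⇔; Equivalence)
open import Relation.Nullary using (¬_; Dec; yes; no)
open import Relation.Binary.PropositionalEquality using (_≡_; _≢_; refl; sym; trans; cong; subst)

module Properties (𝓜 : QTModel) where
  open QTModel 𝓜
  open Notions 𝓜

  private variable
    x y z u v : M

  ∗≢a : ∀ x y → x ∗ y ≢ a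
  ∗≢a x y = proj₁ (qt2 x y)

  ∗≢b : ∀ x y → x ∗ y ≢ b
  ∗≢b x y = proj₂ (qt2 x y)

  ∗b-injective : x ∗ b ≡ y ∗ b → x ≡ y
  ∗b-injective {x} {y} = proj₁ (proj₂ (qt3 x y))

  ∗a≢∗b : ∀ x y → x ∗ a ≢ y ∗ b
  ∗a≢∗b x y = proj₂ (qt4 x y)

  a≢b : a ≢ b
  a≢b a≡b = ∗a≢∗b a a (cong (a ∗_) a≡b)

  data LastDigit : M → Set where
    digit-a : LastDigit a
    digit-b : LastDigit b
    snoc-a  : ∀ w → LastDigit (w ∗ a)
    snoc-b  : ∀ w → LastDigit (w ∗ b)

  lastDigit : ∀ x → LastDigit x
  lastDigit x with qt5 x
  ... | inj₁ refl                           = digit-a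
  ... | inj₂ (inj₁ refl)                    = digit-b
  ... | inj₂ (inj₂ (_ , w , inj₁ refl))     = snoc-a w
  ... | inj₂ (inj₂ (_ , w , inj₂ refl))     = snoc-b w

  data FirstDigit : M → Set where
    digit-a : FirstDigit a
    digit-b : FirstDigit b
    cons-a  : ∀ w → FirstDigit (a ∗ w)
    cons-b  : ∀ w → FirstDigit (b ∗ w)

  firstDigit : ∀ x → FirstDigit x
  firstDigit x with qt5 x
  ... | inj₁ refl                           = digit-a
  ... | inj₂ (inj₁ refl)                    = digit-b
  ... | inj₂ (inj₂ ((w , inj₁ refl) , _))   = cons-a w
  ... | inj₂ (inj₂ ((w , inj₂ refl) , _))   = cons-b w

  ≡a? : ∀ x → Dec (x ≡ a)
  ≡a? x with lastDigit x
  ... | digit-a  = yes refl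
  ... | digit-b  = no (a≢b ∘ sym)
  ... | snoc-a w = no (∗≢a w a)
  ... | snoc-b w = no (∗≢a w b)

  S-a : S a ≡ b
  S-a = Equivalence.from (qt6 a b) (inj₁ (refl , refl))

  S-≢a : x ≢ a → S x ≡ x ∗ b
  S-≢a {x} x≢a = Equivalence.from (qt6 x (x ∗ b)) (inj₂ (x≢a , refl))

  B-trans : x B y → y B z → x B z
  B-trans {x} (u , refl) (v , refl) = u ∗ v , qt1 x u v

  B-∗b : x B y → x B (y ∗ b)
  B-∗b xBy = B-trans xBy (b , refl)

  infix 4 _⊑_
  _⊑_ : M → M → Set
  x ⊑ y = x ≡ y ⊎ x B y

  B∗b⇒⊑ : x B (y ∗ b) → x ⊑ y
  B∗b⇒⊑ {x} {y} (z , e) with lastDigit z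
  ... | digit-a  = ⊥-elim (∗a≢∗b x y e)
  ... | digit-b  = inj₁ (∗b-injective e)
  ... | snoc-a w = ⊥-elim (∗a≢∗b (x ∗ w) y (trans (sym (qt1 x w a)) e))
  ... | snoc-b w = inj₂ (w , ∗b-injective (trans (sym (qt1 x w b)) e))

  ∗b-B-∗b⇒B : (x ∗ b) B (y ∗ b) → x B y
  ∗b-B-∗b⇒B xbByb with B∗b⇒⊑ xbByb
  ... | inj₁ refl    = b , refl
  ... | inj₂ xbBy   = B-trans (b , refl) xbBy

  pattern ⊆p-≡ e            = inj₁ e
  pattern ⊆p-prefix xBy     = inj₂ (inj₁ xBy)
  pattern ⊆p-suffix xEy     = inj₂ (inj₂ (inj₁ xEy))
  pattern ⊆p-infix y₁ y₂ e  = inj₂ (inj₂ (inj₂ (y₁ , y₂ , e)))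

  ⊆p-∗b : x ⊆p y → x ⊆p (y ∗ b)
  ⊆p-∗b     (⊆p-≡ refl)            = ⊆p-prefix (b , refl)
  ⊆p-∗b     (⊆p-prefix xBy)        = ⊆p-prefix (B-∗b xBy)
  ⊆p-∗b {x} (⊆p-suffix (w , refl)) = ⊆p-infix w b (sym (qt1 w x b))
  ⊆p-∗b {x} (⊆p-infix y₁ y₂ refl)  =
    ⊆p-infix y₁ (y₂ ∗ b) (trans (sym (qt1 y₁ (x ∗ y₂) b)) (cong (y₁ ∗_) (sym (qt1 x y₂ b))))

  a⊆p∗b⇒a⊆p : a ⊆p (y ∗ b) → a ⊆p y
  a⊆p∗b⇒a⊆p {y} (⊆p-≡ a≡yb) = ⊥-elim (∗≢a y b (sym a≡yb))
  a⊆p∗b⇒a⊆p (⊆p-prefix aByb) with B∗b⇒⊑ aByb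
  ... | inj₁ a≡y = ⊆p-≡ a≡y
  ... | inj₂ aBy = ⊆p-prefix aBy
  a⊆p∗b⇒a⊆p {y} (⊆p-suffix (z , e)) = ⊥-elim (∗a≢∗b z y e)
  a⊆p∗b⇒a⊆p {y} (⊆p-infix y₁ y₂ e) with B∗b⇒⊑ (y₂ , trans (sym (qt1 y₁ a y₂)) (sym e))
  ... | inj₁ y₁a≡y       = ⊆p-suffix (y₁ , y₁a≡y)
  ... | inj₂ (w , y₁aw≡y) = ⊆p-infix y₁ w (trans (sym y₁aw≡y) (sym (qt1 y₁ a w)))

  ⊆p-b⇒≡b : x ⊆p b → x ≡ b
  ⊆p-b⇒≡b     (⊆p-≡ x≡b)          = x≡b
  ⊆p-b⇒≡b {x} (⊆p-prefix (z , e)) = ⊥-elim (∗≢b x z e)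
  ⊆p-b⇒≡b {x} (⊆p-suffix (z , e)) = ⊥-elim (∗≢b z x e)
  ⊆p-b⇒≡b {x} (⊆p-infix y₁ y₂ e) = ⊥-elim (∗≢b y₁ (x ∗ y₂) (sym e))

  Tally-b⇒a⊈p : Tally-b y → ¬ a ⊆p y
  Tally-b⇒a⊈p t a⊆y = a≢b (t a (a⊆y , inj₁ refl))

  a⊈p⇒Tally-b : ¬ a ⊆p y → Tally-b y
  a⊈p⇒Tally-b a⊈y d (d⊆y , inj₁ refl) = ⊥-elim (a⊈y d⊆y)
  a⊈p⇒Tally-b a⊈y d (_   , inj₂ d≡b)  = d≡b

  Tally-b⇒≢a : Tally-b y → y ≢ a
  Tally-b⇒≢a t refl = Tally-b⇒a⊈p t (⊆p-≡ refl)

  Tally-b-b : Tally-b b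
  Tally-b-b d (d⊆b , _) = ⊆p-b⇒≡b d⊆b

  Tally-b-∗b : Tally-b y → Tally-b (y ∗ b)
  Tally-b-∗b t = a⊈p⇒Tally-b (Tally-b⇒a⊈p t ∘ a⊆p∗b⇒a⊆p)

  Tally-b-∗b⁻¹ : Tally-b (y ∗ b) → Tally-b y
  Tally-b-∗b⁻¹ t d (d⊆y , digit) = t d (⊆p-∗b d⊆y , digit)

  Tally-b-S : Tally-b y → Tally-b (S y)
  Tally-b-S t = subst Tally-b (sym (S-≢a (Tally-b⇒≢a t))) (Tally-b-∗b t)

  Tally-b-inversion : Tally-b y → y ≡ b ⊎ Σ M λ y₁ → Tally-b y₁ × y ≡ S y₁
  Tally-b-inversion {y} t with lastDigit y
  ... | digit-a  = ⊥-elim (Tally-b⇒≢a t refl)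
  ... | digit-b  = inj₁ refl
  ... | snoc-a w = ⊥-elim (Tally-b⇒a⊈p t (⊆p-suffix (w , refl)))
  ... | snoc-b w = inj₂ (w , Tally-b-∗b⁻¹ t , sym (S-≢a w≢a))
    where
    w≢a : w ≢ a
    w≢a refl = Tally-b⇒a⊈p t (⊆p-prefix (b , refl))

  Tally-b⇔≡b⊎S : Tally-b y ⇔ (y ≡ b ⊎ Σ M λ y₁ → Tally-b y₁ × y ≡ S y₁)
  Tally-b⇔≡b⊎S = mk⇔ Tally-b-inversion Tally-b-construction
    where
    Tally-b-construction : y ≡ b ⊎ (Σ M λ y₁ → Tally-b y₁ × y ≡ S y₁) → Tally-b y
    Tally-b-construction (inj₁ refl)            = Tally-b-b
    Tally-b-construction (inj₂ (_ , t , refl)) = Tally-b-S t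

  Tally-b⇒b⊑ : Tally-b v → b ⊑ v
  Tally-b⇒b⊑ {v} t with firstDigit v
  ... | digit-a  = ⊥-elim (Tally-b⇒≢a t refl)
  ... | digit-b  = inj₁ refl
  ... | cons-a w = ⊥-elim (Tally-b⇒a⊈p t (⊆p-prefix (w , refl)))
  ... | cons-b w = inj₂ (w , refl)

  Tally-b⇒∗b⊑ : Tally-b (u ∗ z) → u ∗ b ⊑ u ∗ z
  Tally-b⇒∗b⊑ {u} {z} t with firstDigit z
  ... | digit-a  = ⊥-elim (Tally-b⇒a⊈p t (⊆p-suffix (u , refl)))
  ... | digit-b  = inj₁ refl
  ... | cons-a w = ⊥-elim (Tally-b⇒a⊈p t (⊆p-infix u w refl))
  ... | cons-b w = inj₂ (w , sym (qt1 u b w))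

  Tally-b-R⇒S⊑ : Tally-b v → u R v → S u ⊑ v
  Tally-b-R⇒S⊑ t (inj₁ (refl , _)) = subst (_⊑ _) (sym S-a) (Tally-b⇒b⊑ t)
  Tally-b-R⇒S⊑ {u = u} t (inj₂ (z , refl)) = subst (_⊑ _) (sym (S-≢a u≢a)) (Tally-b⇒∗b⊑ t)
    where
    u≢a : u ≢ a
    u≢a refl = Tally-b⇒a⊈p t (⊆p-prefix (z , refl))

  ¬aRa : ¬ a R a
  ¬aRa (inj₁ (_ , a≢a)) = a≢a refl
  ¬aRa (inj₂ (z , e))   = ∗≢a a z e

  I₀-a : I₀ a
  I₀-a _ (inj₁ (inj₁ (_ , a≢a)))  = ⊥-elim (a≢a refl)
  I₀-a w (inj₁ (inj₂ (z , e)))    = ⊥-elim (∗≢a w z e)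
  I₀-a _ (inj₂ refl)              = ¬aRa

  I₀-B : x B y → I₀ y → I₀ x
  I₀-B xBy I₀y _ (inj₁ (inj₁ (refl , _))) = ¬aRa
  I₀-B xBy I₀y w (inj₁ (inj₂ wBx))        = I₀y w (inj₁ (inj₂ (B-trans wBx xBy)))
  I₀-B xBy I₀y _ (inj₂ refl)              = I₀y _ (inj₁ (inj₂ xBy))

  I₀-∗b⁻¹ : I₀ (y ∗ b) → I₀ y
  I₀-∗b⁻¹ = I₀-B (b , refl)

  I₀-∗b : I₀ y → I₀ (y ∗ b)
  I₀-∗b I₀y _ (inj₁ (inj₁ (refl , _))) = ¬aRa
  I₀-∗b I₀y w (inj₁ (inj₂ wByb)) with B∗b⇒⊑ wByb
  ... | inj₁ refl = I₀y w (inj₂ refl)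
  ... | inj₂ wBy  = I₀y w (inj₁ (inj₂ wBy))
  I₀-∗b {y} I₀y _ (inj₂ refl) = ¬ybRyb
    where
    ¬ybRyb : ¬ (y ∗ b) R (y ∗ b)
    ¬ybRyb (inj₁ (yb≡a , _)) = ∗≢a y b yb≡a
    ¬ybRyb (inj₂ ybByb)      = I₀y y (inj₂ refl) (inj₂ (∗b-B-∗b⇒B ybByb))

  R-∗b : x R y → x R (y ∗ b)
  R-∗b {y = y} (inj₁ (x≡a , _)) = inj₁ (x≡a , ∗≢a y b)
  R-∗b (inj₂ xBy)               = inj₂ (B-∗b xBy)

  ⊑⇒≤ : I₀ y → x ⊑ y → x ≤ y
  ⊑⇒≤ I₀y (inj₁ x≡y) = inj₂ x≡y
  ⊑⇒≤ I₀y (inj₂ xBy) = inj₁ (I₀-B xBy I₀y , I₀y , inj₂ xBy)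

  ≤⇒<∗b : I₀ y → x ≤ y → x < (y ∗ b)
  ≤⇒<∗b I₀y (inj₁ (I₀x , _ , xRy)) = I₀x , I₀-∗b I₀y , R-∗b xRy
  ≤⇒<∗b I₀y (inj₂ refl)            = I₀y , I₀-∗b I₀y , inj₂ (b , refl)

  ∗b-<-∗b⇒< : (x ∗ b) < (y ∗ b) → x < y
  ∗b-<-∗b⇒< {x} (_ , _ , inj₁ (xb≡a , _)) = ⊥-elim (∗≢a x b xb≡a)
  ∗b-<-∗b⇒< (I₀xb , I₀yb , inj₂ xbByb)  = I₀-∗b⁻¹ I₀xb , I₀-∗b⁻¹ I₀yb , inj₂ (∗b-B-∗b⇒B xbByb)

  Tally-b-<⇒S≤ : Tally-b v → u < v → S u ≤ v
  Tally-b-<⇒S≤ t (_ , I₀v , uRv) = ⊑⇒≤ I₀v (Tally-b-R⇒S⊑ t uRv)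

  S-<-mono : Tally-b y → x < y → S x < S y
  S-<-mono {x = x} t x<y@(_ , I₀y , _) =
    subst (S x <_) (sym (S-≢a (Tally-b⇒≢a t))) (≤⇒<∗b I₀y (Tally-b-<⇒S≤ t x<y))

  S-<-cancel : y ≢ a → S x < S y → x < y
  S-<-cancel {y} {x} y≢a Sx<Sy with ≡a? x | subst (S x <_) (S-≢a y≢a) Sx<Sy
  ... | yes refl | _ , I₀yb , _ = I₀-a , I₀-∗b⁻¹ I₀yb , inj₁ (refl , y≢a)
  ... | no x≢a   | Sx<yb        = ∗b-<-∗b⇒< (subst (_< _) (S-≢a x≢a) Sx<yb)

mainTheorem5 : ExcludedMiddle 0ℓ → (𝓜 : QTModel) →
    let open QTModel 𝓜
        open Notions 𝓜
    in (∀ y → Tally-b y → Tally-b (S y))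
       × (∀ y → Tally-b y ⇔ (y ≡ b ⊎ (Σ M λ y₁ → Tally-b y₁ × y ≡ S y₁)))
       × (∀ v u → Tally-b v × u < v → S u ≤ v)
       × (∀ x y → Tally-b y → (x < y ⇔ S x < S y))
mainTheorem5 _ 𝓜 =
    (λ _ → Tally-b-S)
  , (λ _ → Tally-b⇔≡b⊎S)
  , (λ _ _ (t , u<v) → Tally-b-<⇒S≤ t u<v)
  , (λ _ _ t → mk⇔ (S-<-mono t) (S-<-cancel (Tally-b⇒≢a t)))
  where open Properties 𝓜
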